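{- Let $\mathbf h$ be a connected Hopf monoid in species and $\operatorname{supp}(\mathbf h)=\{n\in\mathbb{N}\mid \dim\mathbf h[n]\neq 0\}$. The set $\operatorname{supp}(\mathbf h)$ is either $\{0\}$ or infinite. The set $\mathbb{N}\setminus\operatorname{supp}(\mathbf h)$ is finite if and only if $\gcd\bigl(\operatorname{supp}(\mathbf h)\bigr)=1$.
   Context: Base field $\mathbb{F}$ of arbitrary characteristic. Species are functors from finite sets and bijections to finite-dimensional $\mathbb{F}$-vector spaces; connected means $\mathbf h[\emptyset]=\mathbb{F}$; Hopf monoids are with respect to the Cauchy product; $\mathbf h[n]=\mathbf h[\{1,\dots,n\}]$. -}

module Defs where

open import Level using (Level; _⊔_) renaming (suc to lsuc)
open import Algebra.Bundles using (CommutativeRing)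
open import Data.Nat using (ℕ; zero; suc)
open import Data.Nat.Divisibility using (_∣_)
open import Data.Fin using (Fin; zero; suc)
import Data.Fin as Fin
open import Data.Fin.Subset using (Subset; _∩_; _∪_; _∈_) renaming (⊥ to ∅; ⊤ to full)
open import Data.Vec using (Vec; []; _∷_)
open import Data.Vec.Properties using (≡-dec)
import Data.Bool as Bool
open import Data.List using (List; []; _∷_; map; concatMap; foldr; _++_)
open import Data.List.Membership.Propositional using () renaming (_∈_ to _∈L_)
open import Data.Product using (Σ; ∃; _×_; _,_; proj₁)
open import Function using (_∘_)
open import Function.Bundles using (_↔_; Inverse)
open import Function.Construct.Identity using (↔-id)
open import Function.Construct.Composition using (_↔-∘_)
open import Relation.Nullary using (¬_; Dec; yes; no; does)
open import Relation.Binary.PropositionalEquality using (_≡_)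

record Field (c ℓ : Level) : Set (lsuc (c ⊔ ℓ)) where
  field
    commutativeRing : CommutativeRing c ℓ
  open CommutativeRing commutativeRing public
  field
    0≉1     : ¬ (0# ≈ 1#)
    inverse : ∀ x → ¬ (x ≈ 0#) → ∃ λ y → x * y ≈ 1#

-- We work with the (equivalent) groupoid whose objects are
-- subsets I of some Fin N and whose morphisms are bijections between the
-- underlying element types.  Every finite set is in bijection with such
-- an object, and subsets / decompositions I = S ⊔ T are again objects
-- (S, T : Subset N with S ∩ T ≡ ∅ and S ∪ T ≡ I).

El : ∀ {N} → Subset N → Set
El {N} I = Σ (Fin N) (λ i → i ∈ I)

-- The bijection ρ : S ↔ S' is the restriction of σ : I ↔ J
-- (same underlying element of Fin N goes to the same element of Fin M).
Restricts : ∀ {N M} {I S : Subset N} {J S' : Subset M} →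
            El I ↔ El J → El S ↔ El S' → Set
Restricts σ ρ = ∀ x y → proj₁ x ≡ proj₁ y →
                proj₁ (Inverse.to σ x) ≡ proj₁ (Inverse.to ρ y)

allSubsets : (N : ℕ) → List (Subset N)
allSubsets zero    = [] ∷ []
allSubsets (suc N) = map (Bool.true ∷_) (allSubsets N) ++ map (Bool.false ∷_) (allSubsets N)

_≟S_ : ∀ {N} (S T : Subset N) → Dec (S ≡ T)
_≟S_ = ≡-dec Bool._≟_

module _ {c ℓ} (F : Field c ℓ) where
  open Field F using (Carrier; _≈_; _+_; _*_; 0#; 1#)

  ∑ : (n : ℕ) → (Fin n → Carrier) → Carrier
  ∑ zero    f = 0#
  ∑ (suc n) f = f zero + ∑ n (f ∘ suc)

  δ : ∀ {n} → Fin n → Fin n → Carrier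
  δ i j = Bool.if does (i Fin.≟ j) then 1# else 0#

  ∑dec : ∀ {N} (I : Subset N) →
         ((S T : Subset N) → S ∩ T ≡ ∅ → S ∪ T ≡ I → Carrier) → Carrier
  ∑dec {N} I f = foldr _+_ 0# (concatMap (λ S → map (term S) (allSubsets N)) (allSubsets N))
    where
      term : (S T : Subset N) → Carrier
      term S T with (S ∩ T) ≟S ∅ | (S ∪ T) ≟S I
      ... | yes p | yes q = f S T p q
      ... | _     | _     = 0#

  -- Connected Hopf monoids in species, with values in finite-dimensional
  -- F-vector spaces, written in coordinates: h[I] = F^(dim I), a linear
  -- map F^m → F^n is its matrix (entry (row, column) ↦ Carrier), the
  -- product μ_{S,T} : h[S] ⊗ h[T] → h[I] is given by μ a b k = k-th
  -- coordinate of μ(e_a ⊗ e_b), the coproduct by Δ k a b = coefficient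
  -- of e_a ⊗ e_b in Δ(e_k).  Unit ι_∅ : F → h[∅] is the vector ι(1),
  -- counit ε_∅ : h[∅] → F is the covector ε.

  record HopfMonoid : Set (c ⊔ ℓ) where
    field
      dim    : ∀ {N} → Subset N → ℕ
      act    : ∀ {N M} {I : Subset N} {J : Subset M} →
               El I ↔ El J → Fin (dim J) → Fin (dim I) → Carrier
      act-cong : ∀ {N M} {I : Subset N} {J : Subset M} (σ τ : El I ↔ El J) →
                 (∀ x → Inverse.to σ x ≡ Inverse.to τ x) →
                 ∀ j i → act σ j i ≈ act τ j i
      act-id : ∀ {N} (I : Subset N) j i → act (↔-id (El I)) j i ≈ δ j i
      act-∘  : ∀ {N M K} {I : Subset N} {J : Subset M} {L : Subset K}
               (σ : El I ↔ El J) (τ : El J ↔ El L) k i →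
               act (τ ↔-∘ σ) k i ≈ ∑ (dim J) (λ j → act τ k j * act σ j i)

      connected : ∀ {N} → dim (∅ {N}) ≡ 1

      μ : ∀ {N} {I S T : Subset N} → S ∩ T ≡ ∅ → S ∪ T ≡ I →
          Fin (dim S) → Fin (dim T) → Fin (dim I) → Carrier
      Δ : ∀ {N} {I S T : Subset N} → S ∩ T ≡ ∅ → S ∪ T ≡ I →
          Fin (dim I) → Fin (dim S) → Fin (dim T) → Carrier
      ι : (N : ℕ) → Fin (dim (∅ {N})) → Carrier
      ε : (N : ℕ) → Fin (dim (∅ {N})) → Carrier
      s : ∀ {N} (I : Subset N) → Fin (dim I) → Fin (dim I) → Carrier

      μ-nat : ∀ {N M} {I S T : Subset N} {J S' T' : Subset M}
              (p : S ∩ T ≡ ∅) (q : S ∪ T ≡ I) (p' : S' ∩ T' ≡ ∅) (q' : S' ∪ T' ≡ J)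
              (σ : El I ↔ El J) (σS : El S ↔ El S') (σT : El T ↔ El T') →
              Restricts σ σS → Restricts σ σT → ∀ a b j →
              ∑ (dim I) (λ i → act σ j i * μ p q a b i)
                ≈ ∑ (dim S') (λ a' → ∑ (dim T') (λ b' →
                    (act σS a' a * act σT b' b) * μ p' q' a' b' j))
      Δ-nat : ∀ {N M} {I S T : Subset N} {J S' T' : Subset M}
              (p : S ∩ T ≡ ∅) (q : S ∪ T ≡ I) (p' : S' ∩ T' ≡ ∅) (q' : S' ∪ T' ≡ J)
              (σ : El I ↔ El J) (σS : El S ↔ El S') (σT : El T ↔ El T') →
              Restricts σ σS → Restricts σ σT → ∀ i a' b' →
              ∑ (dim J) (λ j → act σ j i * Δ p' q' j a' b')
                ≈ ∑ (dim S) (λ a → ∑ (dim T) (λ b →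
                    Δ p q i a b * (act σS a' a * act σT b' b)))
      ι-nat : ∀ {N M} (σ : El (∅ {N}) ↔ El (∅ {M})) a' →
              ∑ (dim (∅ {N})) (λ a → act σ a' a * ι N a) ≈ ι M a'
      ε-nat : ∀ {N M} (σ : El (∅ {N}) ↔ El (∅ {M})) a →
              ∑ (dim (∅ {M})) (λ a' → ε M a' * act σ a' a) ≈ ε N a
      s-nat : ∀ {N M} {I : Subset N} {J : Subset M} (σ : El I ↔ El J) j i →
              ∑ (dim I) (λ m → act σ j m * s I m i) ≈ ∑ (dim J) (λ m → s J j m * act σ m i)

      μ-assoc : ∀ {N} {I R S T RS ST : Subset N}
                (p₁ : R ∩ S ≡ ∅) (q₁ : R ∪ S ≡ RS) (p₂ : RS ∩ T ≡ ∅) (q₂ : RS ∪ T ≡ I)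
                (p₃ : S ∩ T ≡ ∅) (q₃ : S ∪ T ≡ ST) (p₄ : R ∩ ST ≡ ∅) (q₄ : R ∪ ST ≡ I)
                x y z k →
                ∑ (dim RS) (λ m → μ p₁ q₁ x y m * μ p₂ q₂ m z k)
                  ≈ ∑ (dim ST) (λ m → μ p₃ q₃ y z m * μ p₄ q₄ x m k)
      μ-unitˡ : ∀ {N} {I : Subset N} (p : ∅ ∩ I ≡ ∅) (q : ∅ ∪ I ≡ I) x k →
                ∑ (dim (∅ {N})) (λ e → ι N e * μ p q e x k) ≈ δ k x
      μ-unitʳ : ∀ {N} {I : Subset N} (p : I ∩ ∅ ≡ ∅) (q : I ∪ ∅ ≡ I) x k →
                ∑ (dim (∅ {N})) (λ e → ι N e * μ p q x e k) ≈ δ k x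

      Δ-coassoc : ∀ {N} {I R S T RS ST : Subset N}
                  (p₁ : R ∩ S ≡ ∅) (q₁ : R ∪ S ≡ RS) (p₂ : RS ∩ T ≡ ∅) (q₂ : RS ∪ T ≡ I)
                  (p₃ : S ∩ T ≡ ∅) (q₃ : S ∪ T ≡ ST) (p₄ : R ∩ ST ≡ ∅) (q₄ : R ∪ ST ≡ I)
                  i x y z →
                  ∑ (dim RS) (λ m → Δ p₂ q₂ i m z * Δ p₁ q₁ m x y)
                    ≈ ∑ (dim ST) (λ m → Δ p₄ q₄ i x m * Δ p₃ q₃ m y z)
      Δ-counitˡ : ∀ {N} {I : Subset N} (p : ∅ ∩ I ≡ ∅) (q : ∅ ∪ I ≡ I) i x →
                  ∑ (dim (∅ {N})) (λ e → Δ p q i e x * ε N e) ≈ δ x i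
      Δ-counitʳ : ∀ {N} {I : Subset N} (p : I ∩ ∅ ≡ ∅) (q : I ∪ ∅ ≡ I) i x →
                  ∑ (dim (∅ {N})) (λ e → Δ p q i x e * ε N e) ≈ δ x i

      -- bimonoid compatibility: for I = S ⊔ T = S' ⊔ T' with
      -- A = S ∩ S', B = S ∩ T', C = T ∩ S', D = T ∩ T' (forced by the
      -- hypotheses below),  Δ_{S',T'} μ_{S,T} = (μ_{A,C} ⊗ μ_{B,D}) (id ⊗ β ⊗ id) (Δ_{A,B} ⊗ Δ_{C,D})
      compat : ∀ {N} {I S T S' T' A B C D : Subset N}
               (p : S ∩ T ≡ ∅) (q : S ∪ T ≡ I) (p' : S' ∩ T' ≡ ∅) (q' : S' ∪ T' ≡ I)
               (pAB : A ∩ B ≡ ∅) (qAB : A ∪ B ≡ S) (pCD : C ∩ D ≡ ∅) (qCD : C ∪ D ≡ T)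
               (pAC : A ∩ C ≡ ∅) (qAC : A ∪ C ≡ S') (pBD : B ∩ D ≡ ∅) (qBD : B ∪ D ≡ T')
               x y x' y' →
               ∑ (dim I) (λ k → μ p q x y k * Δ p' q' k x' y')
                 ≈ ∑ (dim A) (λ a → ∑ (dim B) (λ b → ∑ (dim C) (λ c' → ∑ (dim D) (λ d →
                     (Δ pAB qAB x a b * Δ pCD qCD y c' d)
                       * (μ pAC qAC a c' x' * μ pBD qBD b d y')))))
      ει : ∀ N → ∑ (dim (∅ {N})) (λ e → ι N e * ε N e) ≈ 1#
      Δι : ∀ {N} (p : ∅ ∩ ∅ ≡ ∅) (q : ∅ ∪ ∅ ≡ ∅) a b →
           ∑ (dim (∅ {N})) (λ k → ι N k * Δ p q k a b) ≈ ι N a * ι N b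
      με : ∀ {N} (p : ∅ ∩ ∅ ≡ ∅) (q : ∅ ∪ ∅ ≡ ∅) a b →
           ∑ (dim (∅ {N})) (λ k → μ p q a b k * ε N k) ≈ ε N a * ε N b

      -- antipode: μ (s ⊗ id) Δ = ι ε = μ (id ⊗ s) Δ
      -- (the right-hand side ι ε is zero on h[I] for I ≠ ∅)
      s-leftˢ : ∀ {N} (I : Subset N) → ¬ (I ≡ ∅) → ∀ x k →
                ∑dec I (λ S T p q → ∑ (dim S) (λ a → ∑ (dim T) (λ b →
                   Δ p q x a b * ∑ (dim S) (λ a' → s S a' a * μ p q a' b k)))) ≈ 0#
      s-left∅ : ∀ N x k →
                ∑dec (∅ {N}) (λ S T p q → ∑ (dim S) (λ a → ∑ (dim T) (λ b →
                   Δ p q x a b * ∑ (dim S) (λ a' → s S a' a * μ p q a' b k)))) ≈ ι N k * ε N x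
      s-rightˢ : ∀ {N} (I : Subset N) → ¬ (I ≡ ∅) → ∀ x k →
                 ∑dec I (λ S T p q → ∑ (dim S) (λ a → ∑ (dim T) (λ b →
                    Δ p q x a b * ∑ (dim T) (λ b' → s T b' b * μ p q a b' k)))) ≈ 0#
      s-right∅ : ∀ N x k →
                 ∑dec (∅ {N}) (λ S T p q → ∑ (dim S) (λ a → ∑ (dim T) (λ b →
                    Δ p q x a b * ∑ (dim T) (λ b' → s T b' b * μ p q a b' k)))) ≈ ι N k * ε N x

-- dim h[n] = dim h[{1,…,n}]; here [n] is the full subset of Fin n
dimₙ : ∀ {c ℓ} {F : Field c ℓ} → HopfMonoid F → ℕ → ℕ
dimₙ h n = HopfMonoid.dim h (full {n})

supp : ∀ {c ℓ} {F : Field c ℓ} → HopfMonoid F → ℕ → Set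
supp h n = ¬ (dimₙ h n ≡ 0)

FiniteSet : (ℕ → Set) → Set
FiniteSet P = ∃ λ (xs : List ℕ) → ∀ n → P n → n ∈L xs

InfiniteSet : (ℕ → Set) → Set
InfiniteSet P = ¬ FiniteSet P

IsSingletonZero : (ℕ → Set) → Set
IsSingletonZero P = P 0 × (∀ n → P n → n ≡ 0)

IsGCDOf : (ℕ → Set) → ℕ → Set
IsGCDOf P g = (∀ n → P n → g ∣ n) × (∀ k → (∀ n → P n → k ∣ n) → k ∣ g)

module Submission where

-- The only input from Hopf theory is that supp(h) is an additive submonoid
-- of ℕ.  It contains 0 because h[∅] = F.  It is closed under addition
-- because in a connected bimonoid Δ_{S,T} ∘ μ_{S,T} is the identity of
-- h[S] ⊗ h[T] (compatibility applied to S = S ⊔ ∅, T = ∅ ⊔ T plus the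
-- (co)unit laws), so μ_{S,T} is injective and h[S], h[T] ≠ 0 give
-- h[S ⊔ T] ≠ 0; dimensions are invariant under bijections, which lets us
-- realise [m + n] as the disjoint union of padded copies of [m] and [n].
--
-- The rest is number theory of additive submonoids M ⊆ ℕ, using excluded
-- middle to decide statements quantified over ℕ: M contains the multiples of
-- its elements, hence is {0} or unbounded; a cofinite M contains consecutive
-- numbers, so has gcd 1; conversely, if gcd M = 1 a Euclidean descent on
-- the distance between two elements of M produces x, x + 1 ∈ M, and then
-- every n ≥ x² is a sum of copies of x and x + 1.

open import Defs
open import Level using (_⊔_; Lift; lift; lower)
open import Axiom.ExcludedMiddle using (ExcludedMiddle)
open import Data.Nat using (ℕ; zero; suc; _≟_)
open import Data.Fin using (Fin; zero; suc)
import Data.Fin as Fin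
open import Data.Fin.Subset using (Subset; _∩_; _∪_) renaming (⊥ to ∅; ⊤ to full)
open import Data.Fin.Subset.Properties using (∩-zeroʳ; ∩-zeroˡ; ∪-identityʳ; ∪-identityˡ; ∉⊥)
open import Data.Vec using ([]; _∷_; _++_; here; there)
open import Data.Bool using (Bool; false; true)
open import Data.Product using (_×_; _,_; proj₁; proj₂)
open import Data.Sum using (_⊎_)
open import Data.Empty using (⊥-elim)
open import Function using (_∘_)
open import Function.Bundles using (_⇔_; mk⇔; _↔_; Inverse; mk↔ₛ′)
open import Function.Construct.Identity using (↔-id)
open import Function.Construct.Composition using (_↔-∘_)
open import Function.Construct.Symmetry using (↔-sym)
open import Relation.Nullary using (¬_; Dec; yes; no; ¬?)
open import Relation.Nullary.Decidable using (map′)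
import Relation.Binary.PropositionalEquality as ≡
open import Relation.Binary.PropositionalEquality using (_≡_)
import Algebra.Properties.Semiring.Sum as SemiringSum
import Algebra.Solver.CommutativeMonoid as CommutativeMonoidSolver
import Relation.Binary.Reasoning.Setoid as SetoidReasoning

module FieldSums {c ℓ} (F : Field c ℓ) where
  open Field F hiding (zero)
  open SemiringSum semiring using (sum; sum-cong-≋; sum-replicate-zero; *-distribˡ-sum; *-distribʳ-sum)
  open SetoidReasoning setoid

  -- Both sums are the same right fold, so the library's lemmas transfer.
  ∑≡sum : ∀ n (f : Fin n → Carrier) → ∑ F n f ≡ sum f
  ∑≡sum zero    f = ≡.refl
  ∑≡sum (suc n) f = ≡.cong (f zero +_) (∑≡sum n (f ∘ suc))

  ∑-cong : ∀ n {f g : Fin n → Carrier} → (∀ i → f i ≈ g i) → ∑ F n f ≈ ∑ F n g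
  ∑-cong n {f} {g} f≈g = begin
    ∑ F n f ≡⟨ ∑≡sum n f ⟩
    sum f   ≈⟨ sum-cong-≋ f≈g ⟩
    sum g   ≡⟨ ≡.sym (∑≡sum n g) ⟩
    ∑ F n g ∎

  ∑-*ˡ : ∀ n c (f : Fin n → Carrier) → c * ∑ F n f ≈ ∑ F n (λ i → c * f i)
  ∑-*ˡ n c f = begin
    c * ∑ F n f               ≡⟨ ≡.cong (c *_) (∑≡sum n f) ⟩
    c * sum f                 ≈⟨ *-distribˡ-sum c f ⟩
    sum (λ i → c * f i)       ≡⟨ ≡.sym (∑≡sum n _) ⟩
    ∑ F n (λ i → c * f i)     ∎

  ∑-*ʳ : ∀ n c (f : Fin n → Carrier) → ∑ F n f * c ≈ ∑ F n (λ i → f i * c)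
  ∑-*ʳ n c f = begin
    ∑ F n f * c               ≡⟨ ≡.cong (_* c) (∑≡sum n f) ⟩
    sum f * c                 ≈⟨ *-distribʳ-sum c f ⟩
    sum (λ i → f i * c)       ≡⟨ ≡.sym (∑≡sum n _) ⟩
    ∑ F n (λ i → f i * c)     ∎

  ∑∑-product : ∀ m n (f : Fin m → Carrier) (g : Fin n → Carrier) →
               ∑ F m (λ a → ∑ F n (λ b → f a * g b)) ≈ ∑ F m f * ∑ F n g
  ∑∑-product m n f g = begin
    ∑ F m (λ a → ∑ F n (λ b → f a * g b)) ≈⟨ ∑-cong m (λ a → sym (∑-*ˡ n (f a) g)) ⟩
    ∑ F m (λ a → f a * ∑ F n g)           ≈⟨ sym (∑-*ʳ m (∑ F n g) f) ⟩
    ∑ F m f * ∑ F n g                     ∎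

  -- Sums indexed by an empty type vanish, so a sum equal to 1 has a nonempty index set.
  ∑-index-nonempty : ∀ n (f : Fin n → Carrier) → ∑ F n f ≈ 1# → ¬ n ≡ 0
  ∑-index-nonempty .0 f ∑f≈1 ≡.refl = 0≉1 ∑f≈1

  the-index : ∀ {n} → n ≡ 1 → Fin n
  the-index ≡.refl = zero

  ∑-singleton : ∀ {n} (n≡1 : n ≡ 1) (f : Fin n → Carrier) → ∑ F n f ≈ f (the-index n≡1)
  ∑-singleton ≡.refl f = +-identityʳ (f zero)

  δ-refl : ∀ {n} (i : Fin n) → δ F i i ≈ 1#
  δ-refl i with i Fin.≟ i
  ... | yes _ = refl
  ... | no i≢i = ⊥-elim (i≢i ≡.refl)

  ∑-δ : ∀ n (i : Fin n) (g : Fin n → Carrier) → ∑ F n (λ j → δ F j i * g j) ≈ g i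
  ∑-δ (suc n) zero g = begin
    1# * g zero + ∑ F n (λ j → 0# * g (suc j)) ≈⟨ +-cong (*-identityˡ _) (∑-cong n (λ j → zeroˡ _)) ⟩
    g zero + ∑ F n (λ _ → 0#)                  ≡⟨ ≡.cong (g zero +_) (∑≡sum n _) ⟩
    g zero + sum {n} (λ _ → 0#)                ≈⟨ +-congˡ (sum-replicate-zero n) ⟩
    g zero + 0#                                ≈⟨ +-identityʳ _ ⟩
    g zero                                     ∎
  ∑-δ (suc n) (suc i) g = begin
    0# * g zero + ∑ F n (λ j → δ F j i * g (suc j)) ≈⟨ +-cong (zeroˡ _) (∑-δ n i (g ∘ suc)) ⟩
    0# + g (suc i)                                  ≈⟨ +-identityˡ _ ⟩
    g (suc i)                                       ∎

  ∑-δδ : ∀ n (i : Fin n) → ∑ F n (λ j → δ F j i * δ F i j) ≈ 1#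
  ∑-δδ n i = trans (∑-δ n i (δ F i)) (δ-refl i)

module HopfFacts {c ℓ} (F : Field c ℓ) (h : HopfMonoid F) where
  open Field F hiding (zero)
  open FieldSums F
  open HopfMonoid h
  open SetoidReasoning setoid
  open CommutativeMonoidSolver *-commutativeMonoid using (solve; _⊕_; _⊜_)

  some-index : ∀ {k} → ¬ k ≡ 0 → Fin k
  some-index {zero}  k≢0 = ⊥-elim (k≢0 ≡.refl)
  some-index {suc k} _   = zero

  -- Dimension is invariant under bijections: the identity action on h[I],
  -- which has diagonal entries 1, factors through h[J] as σ⁻¹ ∘ σ.
  dim-invariant : ∀ {N M} {I : Subset N} {J : Subset M} →
                  El I ↔ El J → ¬ dim I ≡ 0 → ¬ dim J ≡ 0
  dim-invariant {I = I} {J} σ dimI≢0 = ∑-index-nonempty (dim J) _ (begin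
    ∑ F (dim J) (λ j → act (↔-sym σ) i j * act σ j i) ≈⟨ sym (act-∘ σ (↔-sym σ) i i) ⟩
    act (↔-sym σ ↔-∘ σ) i i                           ≈⟨ act-cong _ (↔-id _) (Inverse.strictlyInverseʳ σ) i i ⟩
    act (↔-id (El I)) i i                             ≈⟨ act-id I i i ⟩
    δ F i i                                           ≈⟨ δ-refl i ⟩
    1#                                                ∎)
    where i = some-index dimI≢0

  -- Connectedness: h[∅] = F is spanned by one basis vector, on which the unit
  -- and counit take values ι₀ and ε₀; the (co)unit laws for the trivial
  -- decompositions I = I ⊔ ∅ = ∅ ⊔ I then read as scalar identities.
  module Connected (N : ℕ) where
    ∅-index : Fin (dim (∅ {N}))
    ∅-index = the-index connected

    ι₀ ε₀ : Carrier
    ι₀ = ι N ∅-index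
    ε₀ = ε N ∅-index

    ι₀ε₀≈1 : ι₀ * ε₀ ≈ 1#
    ι₀ε₀≈1 = trans (sym (∑-singleton connected _)) (ει N)

    counitʳ : ∀ {I : Subset N} x a → Δ (∩-zeroʳ I) (∪-identityʳ I) x a ∅-index * ε₀ ≈ δ F a x
    counitʳ {I} x a = trans (sym (∑-singleton connected _)) (Δ-counitʳ (∩-zeroʳ I) (∪-identityʳ I) x a)

    counitˡ : ∀ {I : Subset N} x a → Δ (∩-zeroˡ I) (∪-identityˡ I) x ∅-index a * ε₀ ≈ δ F a x
    counitˡ {I} x a = trans (sym (∑-singleton connected _)) (Δ-counitˡ (∩-zeroˡ I) (∪-identityˡ I) x a)

    unitʳ : ∀ {I : Subset N} a x → ι₀ * μ (∩-zeroʳ I) (∪-identityʳ I) a ∅-index x ≈ δ F x a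
    unitʳ {I} a x = trans (sym (∑-singleton connected _)) (μ-unitʳ (∩-zeroʳ I) (∪-identityʳ I) a x)

    unitˡ : ∀ {I : Subset N} a x → ι₀ * μ (∩-zeroˡ I) (∪-identityˡ I) ∅-index a x ≈ δ F x a
    unitˡ {I} a x = trans (sym (∑-singleton connected _)) (μ-unitˡ (∩-zeroˡ I) (∪-identityˡ I) a x)

  -- In a connected bimonoid Δ_{S,T} ∘ μ_{S,T} is the identity of h[S] ⊗ h[T];
  -- we need its diagonal coefficients.  Compatibility with the decompositions
  -- S = S ⊔ ∅ and T = ∅ ⊔ T reduces the coefficient to (co)unit laws.
  Δμ-diagonal : ∀ {N} {I S T : Subset N} (p : S ∩ T ≡ ∅) (q : S ∪ T ≡ I) x y →
                ∑ F (dim I) (λ k → μ p q x y k * Δ p q k x y) ≈ 1#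
  Δμ-diagonal {N} {I} {S} {T} p q x y = begin
    D                                               ≈⟨ sym (*-identityʳ D) ⟩
    D * 1#                                          ≈⟨ *-congˡ (sym K≈1) ⟩
    D * K                                           ≈⟨ *-congʳ (compat p q p q pS qS pT qT pS qS pT qT x y x y) ⟩
    ∑ F (dim S) (λ a → ∑ F (dim ∅) (λ b → ∑ F (dim ∅) (λ c → ∑ F (dim T) (λ d →
      (Δ pS qS x a b * Δ pT qT y c d) * (μ pS qS a c x * μ pT qT b d y))))) * K
                                                    ≈⟨ *-congʳ (∑-cong (dim S) (λ a →
                                                         trans (∑-singleton connected _) (∑-singleton connected _))) ⟩
    ∑ F (dim S) (λ a → ∑ F (dim T) (term a)) * K     ≈⟨ ∑-*ʳ (dim S) K _ ⟩
    ∑ F (dim S) (λ a → ∑ F (dim T) (term a) * K)     ≈⟨ ∑-cong (dim S) (λ a → ∑-*ʳ (dim T) K (term a)) ⟩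
    ∑ F (dim S) (λ a → ∑ F (dim T) (λ d → term a d * K))
                                                    ≈⟨ ∑-cong (dim S) (λ a → ∑-cong (dim T) (term*K a)) ⟩
    ∑ F (dim S) (λ a → ∑ F (dim T) (λ d → (δ F a x * δ F x a) * (δ F d y * δ F y d)))
                                                    ≈⟨ ∑∑-product (dim S) (dim T) _ _ ⟩
    ∑ F (dim S) (λ a → δ F a x * δ F x a) * ∑ F (dim T) (λ d → δ F d y * δ F y d)
                                                    ≈⟨ *-cong (∑-δδ (dim S) x) (∑-δδ (dim T) y) ⟩
    1# * 1#                                         ≈⟨ *-identityˡ 1# ⟩
    1#                                              ∎
    where
    open Connected N

    D : Carrier
    D = ∑ F (dim I) (λ k → μ p q x y k * Δ p q k x y)

    pS : S ∩ ∅ ≡ ∅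
    pS = ∩-zeroʳ S
    qS : S ∪ ∅ ≡ S
    qS = ∪-identityʳ S
    pT : ∅ ∩ T ≡ ∅
    pT = ∩-zeroˡ T
    qT : ∅ ∪ T ≡ T
    qT = ∪-identityˡ T

    z : Fin (dim (∅ {N}))
    z = ∅-index

    -- the factor (ε₀ ι₀)², equal to 1, by which each term is rescaled
    K : Carrier
    K = (ε₀ * ε₀) * (ι₀ * ι₀)

    K≈1 : K ≈ 1#
    K≈1 = begin
      (ε₀ * ε₀) * (ι₀ * ι₀) ≈⟨ solve 2 (λ e i → (e ⊕ e) ⊕ (i ⊕ i) ⊜ (i ⊕ e) ⊕ (i ⊕ e)) refl ε₀ ι₀ ⟩
      (ι₀ * ε₀) * (ι₀ * ε₀) ≈⟨ *-cong ι₀ε₀≈1 ι₀ε₀≈1 ⟩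
      1# * 1#               ≈⟨ *-identityˡ 1# ⟩
      1#                    ∎

    term : Fin (dim S) → Fin (dim T) → Carrier
    term a d = (Δ pS qS x a z * Δ pT qT y z d) * (μ pS qS a z x * μ pT qT z d y)

    term*K : ∀ a d → term a d * K ≈ (δ F a x * δ F x a) * (δ F d y * δ F y d)
    term*K a d = begin
      term a d * K
        ≈⟨ solve 6 (λ Δ₁ Δ₂ μ₁ μ₂ e i →
             ((Δ₁ ⊕ Δ₂) ⊕ (μ₁ ⊕ μ₂)) ⊕ ((e ⊕ e) ⊕ (i ⊕ i))
               ⊜ ((Δ₁ ⊕ e) ⊕ (i ⊕ μ₁)) ⊕ ((Δ₂ ⊕ e) ⊕ (i ⊕ μ₂)))
           refl (Δ pS qS x a z) (Δ pT qT y z d) (μ pS qS a z x) (μ pT qT z d y) ε₀ ι₀ ⟩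
      ((Δ pS qS x a z * ε₀) * (ι₀ * μ pS qS a z x)) * ((Δ pT qT y z d * ε₀) * (ι₀ * μ pT qT z d y))
        ≈⟨ *-cong (*-cong (counitʳ x a) (unitʳ a x)) (*-cong (counitˡ y d) (unitˡ d y)) ⟩
      (δ F a x * δ F x a) * (δ F d y * δ F y d) ∎

  dim-product : ∀ {N} {I S T : Subset N} → S ∩ T ≡ ∅ → S ∪ T ≡ I →
                ¬ dim S ≡ 0 → ¬ dim T ≡ 0 → ¬ dim I ≡ 0
  dim-product p q dimS≢0 dimT≢0 =
    ∑-index-nonempty _ _ (Δμ-diagonal p q (some-index dimS≢0) (some-index dimT≢0))

-- Padding a subset of Fin m by n
-- absent points, on either side, does not change its element type; this
-- realises [m] and [n] as the blocks of [m + n] = [m] ⊔ [n].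
module Padding where
  open import Data.Nat using (_+_)

  El-[]↔El-∅ : ∀ {n} → El {0} [] ↔ El (∅ {n})
  El-[]↔El-∅ = mk↔ₛ′ (λ { (() , _) }) (λ { (i , i∈∅) → ⊥-elim (∉⊥ i∈∅) })
                     (λ { (i , i∈∅) → ⊥-elim (∉⊥ i∈∅) }) (λ { (() , _) })

  extend : ∀ {m n} {b : Bool} {S : Subset m} {S' : Subset n} →
           (El S → El S') → El (b ∷ S) → El (b ∷ S')
  extend f (zero , here)        = zero , here
  extend f (suc i , there i∈S)  = suc (proj₁ (f (i , i∈S))) , there (proj₂ (f (i , i∈S)))

  extend-inverse : ∀ {m n} {b : Bool} {S : Subset m} {S' : Subset n} (f : El S → El S') (g : El S' → El S) →
                   (∀ x → g (f x) ≡ x) → ∀ x → extend {b = b} g (extend f x) ≡ x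
  extend-inverse f g g∘f≡id (zero , here)       = ≡.refl
  extend-inverse f g g∘f≡id (suc i , there i∈S) =
    ≡.cong (λ x → suc (proj₁ x) , there (proj₂ x)) (g∘f≡id (i , i∈S))

  extend-↔ : ∀ {m n} {b : Bool} {S : Subset m} {S' : Subset n} → El S ↔ El S' → El (b ∷ S) ↔ El (b ∷ S')
  extend-↔ σ = mk↔ₛ′ (extend to) (extend from)
    (extend-inverse from to strictlyInverseˡ) (extend-inverse to from strictlyInverseʳ)
    where open Inverse σ

  shift-↔ : ∀ {n} {S : Subset n} → El S ↔ El (false ∷ S)
  shift-↔ = mk↔ₛ′ (λ { (i , i∈S) → suc i , there i∈S }) (λ { (suc i , there i∈S) → i , i∈S })
                  (λ { (suc i , there i∈S) → ≡.refl }) (λ { (i , i∈S) → ≡.refl })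

  pad-right : ∀ {m n} (S : Subset m) → El S ↔ El (S ++ ∅ {n})
  pad-right []      = El-[]↔El-∅
  pad-right (b ∷ S) = extend-↔ (pad-right S)

  pad-left : ∀ m {n} (S : Subset n) → El S ↔ El (∅ {m} ++ S)
  pad-left zero    S = ↔-id _
  pad-left (suc m) S = shift-↔ ↔-∘ pad-left m S

  blocks-disjoint : ∀ m n → (full {m} ++ ∅ {n}) ∩ (∅ {m} ++ full {n}) ≡ ∅
  blocks-disjoint zero    n = ∩-zeroˡ full
  blocks-disjoint (suc m) n = ≡.cong (false ∷_) (blocks-disjoint m n)

  blocks-cover : ∀ m n → (full {m} ++ ∅ {n}) ∪ (∅ {m} ++ full {n}) ≡ full
  blocks-cover zero    n = ∪-identityˡ full
  blocks-cover (suc m) n = ≡.cong (true ∷_) (blocks-cover m n)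

module Support {c ℓ} {F : Field c ℓ} (h : HopfMonoid F) where
  open import Data.Nat using (_+_)
  open HopfMonoid h using (connected)
  open HopfFacts F h using (dim-invariant; dim-product)
  open Padding

  supp-zero : supp h 0
  supp-zero dim∅≡0 with ≡.trans (≡.sym dim∅≡0) (connected {0})
  ... | ()

  -- [m + n] = [m] ⊔ [n], with h[[m]] ≅ h[m] and h[[n]] ≅ h[n] through padding
  supp-+ : ∀ m n → supp h m → supp h n → supp h (m + n)
  supp-+ m n m∈supp n∈supp = dim-product (blocks-disjoint m n) (blocks-cover m n)
    (dim-invariant (pad-right full) m∈supp) (dim-invariant (pad-left m full) n∈supp)

module NumericalMonoids where

  open import Data.Nat using (ℕ; zero; suc; pred; _+_; _*_; _∸_; _≤_; _<_; s<s⁻¹)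
  open import Data.Nat.Properties
    using (<⇒≱; m≤m*n; +-comm; n≤1+n; ≤-refl; ≤-trans; <⇒≤; *-identityʳ; m∸n+n≡m; ≮⇒≥; _<?_)
  open import Data.Nat.DivMod using (_/_; _%_; m≡m%n+[m/n]*n; m%n<n; m*n/n≡m; /-monoˡ-≤)
  open import Data.Nat.Divisibility using (_∣_; _∣?_; divides; 1∣_; ∣1⇒≡1; ∣m+n∣m⇒∣n; m%n≡0⇒n∣m)
  open import Data.Nat.Induction using (<-rec)
  open import Data.Nat.Tactic.RingSolver using (solve-∀)
  open import Data.List using (upTo)
  open import Data.List.Extrema.Nat using (max; xs≤max)
  open import Data.List.Membership.Propositional using () renaming (_∈_ to _∈L_)
  open import Data.List.Membership.Propositional.Properties using (∈-upTo⁺)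
  import Data.List.Relation.Unary.All as All
  open import Data.Product using (∃; _,_; proj₂)
  open import Data.Sum using (inj₁; inj₂)
  open import Relation.Nullary using (Dec; yes; no; contradiction)
  open import Relation.Binary.PropositionalEquality using (_≡_; refl; sym; cong; subst; module ≡-Reasoning)

  ∈⇒≤max : ∀ {n xs} → n ∈L xs → n ≤ max 0 xs
  ∈⇒≤max {xs = xs} n∈xs = All.lookup (xs≤max 0 xs) n∈xs

  -- Additive submonoids M of ℕ with decidable membership.  Excluded middle
  -- (em) decides the statements quantified over all of ℕ.
  module AdditiveSubmonoid (M : ℕ → Set) (0∈M : M 0) (+-closed : ∀ m n → M m → M n → M (m + n))
                           (M? : ∀ n → Dec (M n)) (em : (P : Set) → Dec P) where

    multiples : ∀ k {a} → M a → M (k * a)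
    multiples zero    a∈M = 0∈M
    multiples (suc k) a∈M = +-closed _ _ a∈M (multiples k a∈M)

    -- A positive element has unboundedly large multiples, so M is {0} or infinite.
    zero-or-infinite : IsSingletonZero M ⊎ InfiniteSet M
    zero-or-infinite with em (∃ λ p → M (suc p))
    ... | no  no-positive = inj₁ (0∈M , λ { zero _ → refl ; (suc p) p∈M → ⊥-elim (no-positive (p , p∈M)) })
    ... | yes (p , p∈M)   = inj₂ λ (xs , M⊆xs) →
      let k = suc (max 0 xs) in
      <⇒≱ (m≤m*n k (suc p)) (∈⇒≤max (M⊆xs (k * suc p) (multiples k p∈M)))

    beyond-complement : ∀ xs → (∀ n → ¬ M n → n ∈L xs) → ∀ n → max 0 xs < n → M n
    beyond-complement xs ∁M⊆xs n max<n with M? n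
    ... | yes n∈M = n∈M
    ... | no  n∉M = contradiction (∈⇒≤max (∁M⊆xs n n∉M)) (<⇒≱ max<n)

    -- A cofinite M contains two consecutive numbers, which only 1 divides.
    cofinite⇒gcd-one : FiniteSet (λ n → ¬ M n) → IsGCDOf M 1
    cofinite⇒gcd-one (xs , ∁M⊆xs) = (λ n _ → 1∣ n) , λ k k∣M →
      ∣m+n∣m⇒∣n (subst (k ∣_) (+-comm 1 B) (k∣M (suc B) (in-M (suc B) (n≤1+n B))))
                (k∣M B (in-M B ≤-refl))
      where
      B : ℕ
      B = suc (max 0 xs)
      in-M : ∀ n → max 0 xs < n → M n
      in-M = beyond-complement xs ∁M⊆xs

    Gap : ℕ → Set
    Gap d = ∃ λ x → M x × M (x + suc d)

    -- Euclidean step: if x, x + D ∈ M and s ∈ M leaves remainder suc r modulo D,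
    -- then q(x + D) and s + qx = q(x + D) + suc r lie in M, where q = s / D.
    narrower-gap : ∀ {d r s} → Gap d → M s → s % suc d ≡ suc r → Gap r
    narrower-gap {d} {r} {s} (x , x∈M , x+D∈M) s∈M s%D≡1+r =
      q * (x + D) , multiples q x+D∈M , subst M s+qx≡q[x+D]+1+r (+-closed s (q * x) s∈M (multiples q x∈M))
      where
      D q : ℕ
      D = suc d
      q = s / D
      regroup : ∀ r q D x → (r + q * D) + q * x ≡ q * (x + D) + r
      regroup = solve-∀
      s+qx≡q[x+D]+1+r : s + q * x ≡ q * (x + D) + suc r
      s+qx≡q[x+D]+1+r = begin
        s + q * x                 ≡⟨ cong (_+ q * x) (m≡m%n+[m/n]*n s D) ⟩
        (s % D + q * D) + q * x   ≡⟨ cong (λ t → (t + q * D) + q * x) s%D≡1+r ⟩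
        (suc r + q * D) + q * x   ≡⟨ regroup (suc r) q D x ⟩
        q * (x + D) + suc r       ∎
        where open ≡-Reasoning

    module _ (gcd-one : IsGCDOf M 1) where

      -- Descent on the gap: either some element of M is not a multiple of
      -- D = suc d, giving a narrower gap, or D divides all of M, so D ∣ 1.
      consecutive : ∀ d → Gap d → Gap 0
      consecutive = <-rec (λ d → Gap d → Gap 0) step
        where
        step : ∀ d → (∀ {r} → r < d → Gap r → Gap 0) → Gap d → Gap 0
        step d narrower gap with em (∃ λ s → M s × ¬ suc d ∣ s)
        ... | yes (s , s∈M , D∤s) with s % suc d in s%D
        ...   | zero  = contradiction (m%n≡0⇒n∣m s (suc d) s%D) D∤s
        ...   | suc r = narrower (s<s⁻¹ (subst (_< suc d) s%D (m%n<n s (suc d)))) (narrower-gap gap s∈M s%D)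
        step d narrower (x , x∈M , x+D∈M) | no no-witness =
          x , x∈M , subst (λ e → M (x + suc e)) d≡0 x+D∈M
          where
          D∣M : ∀ s → M s → suc d ∣ s
          D∣M s s∈M with suc d ∣? s
          ... | yes D∣s = D∣s
          ... | no  D∤s = contradiction (s , s∈M , D∤s) no-witness
          d≡0 : d ≡ 0
          d≡0 = cong pred (∣1⇒≡1 (proj₂ gcd-one (suc d) D∣M))

      -- M has a positive element: otherwise 2 would divide every element.
      some-gap : ∃ Gap
      some-gap with em (∃ λ p → M (suc p))
      ... | yes (p , p∈M)   = p , 0 , 0∈M , p∈M
      ... | no  no-positive = contradiction (∣1⇒≡1 (proj₂ gcd-one 2 2∣M)) λ ()
        where
        2∣M : ∀ n → M n → 2 ∣ n
        2∣M zero    _   = divides 0 refl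
        2∣M (suc p) p∈M = contradiction (p , p∈M) no-positive

    -- If x, x + 1 ∈ M then every n ≥ x² is in M: writing n = qx + r with
    -- r < x ≤ q, we have n = (q ∸ r)x + r(x + 1).
    beyond-consecutive : ∀ x → M x → M (x + 1) → ∀ n → x * x ≤ n → M n
    beyond-consecutive zero     _   1∈M n _     = subst M (*-identityʳ n) (multiples n 1∈M)
    beyond-consecutive x@(suc _) x∈M x+1∈M n x²≤n =
      subst M n≡combination (+-closed _ _ (multiples (q ∸ r) x∈M) (multiples r x+1∈M))
      where
      q r : ℕ
      q = n / x
      r = n % x
      r≤q : r ≤ q
      r≤q = ≤-trans (<⇒≤ (m%n<n n x)) (subst (_≤ q) (m*n/n≡m x x) (/-monoˡ-≤ x x²≤n))
      regroup : ∀ t r x → t * x + r * (x + 1) ≡ r + (t + r) * x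
      regroup = solve-∀
      n≡combination : (q ∸ r) * x + r * (x + 1) ≡ n
      n≡combination = begin
        (q ∸ r) * x + r * (x + 1)  ≡⟨ regroup (q ∸ r) r x ⟩
        r + ((q ∸ r) + r) * x      ≡⟨ cong (λ t → r + t * x) (m∸n+n≡m r≤q) ⟩
        r + q * x                  ≡⟨ sym (m≡m%n+[m/n]*n n x) ⟩
        n                          ∎
        where open ≡-Reasoning

    gcd-one⇒cofinite : IsGCDOf M 1 → FiniteSet (λ n → ¬ M n)
    gcd-one⇒cofinite gcd-one with consecutive gcd-one _ (proj₂ (some-gap gcd-one))
    ... | x , x∈M , x+1∈M = upTo (x * x) , λ n n∉M → ∈-upTo⁺ (below n n∉M)
      where
      below : ∀ n → ¬ M n → n < x * x
      below n n∉M with n <? x * x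
      ... | yes n<x² = n<x²
      ... | no  n≮x² = contradiction (beyond-consecutive x x∈M x+1∈M n (≮⇒≥ n≮x²)) n∉M

corollary4p6 : ∀ {c ℓ} (F : Field c ℓ) → ExcludedMiddle (c ⊔ ℓ) → (h : HopfMonoid F) →
    (IsSingletonZero (supp h) ⊎ InfiniteSet (supp h))
    × (FiniteSet (λ n → ¬ supp h n) ⇔ IsGCDOf (supp h) 1)
corollary4p6 {c} {ℓ} F em h =
  zero-or-infinite , mk⇔ cofinite⇒gcd-one gcd-one⇒cofinite
  where
  em₀ : (P : Set) → Dec P
  em₀ P = map′ lower lift (em {Lift (c ⊔ ℓ) P})

  supp? : ∀ n → Dec (supp h n)
  supp? n = ¬? (dimₙ h n ≟ 0)

  open Support h using (supp-zero; supp-+)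
  open NumericalMonoids.AdditiveSubmonoid (supp h) supp-zero supp-+ supp? em₀
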